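{- (1) The $\mathrm{SL}_2(\mathbb Z)$-module $\Xi_0$ is generated by the symbol $\{\infty,0\}$ and the infinitesimal symbols $[0,t]_\infty$ for $t\in\mathbb Q$. (2) The $\mathrm{SL}_2(\mathbb Z)$-module $W=\ker(\partial:\Xi\to\Delta)$ is generated by the infinitesimal symbols $[0,t]_\infty$ for $t\in\mathbb Q$.
   Context: $\mathcal P(\mathbb Q)$ is the set of formal symbols $\pi_r(s)$ for $r\neq s\in\mathbb P^1(\mathbb Q)$, with $\gamma\pi_r(s)=\pi_{\gamma r}(\gamma s)$ for $\gamma\in\mathrm{GL}_2(\mathbb Q)$. $\Xi$ is the free abelian group on $\mathcal P(\mathbb Q)$, $\Xi_0$ the subgroup of degree zero; $[c_1,c_2]=\{c_2\}-\{c_1\}$; $\{r,s\}=[\pi_r(s),\pi_s(r)]$ (modular symbol) and $[s,t]_r=[\pi_r(s),\pi_r(t)]$ for $s,t\ne r$ (infinitesimal symbol based at $r$). $\Delta=\mathbb Z[\mathbb P^1(\mathbb Q)]$, and $\partial:\Xi\to\Delta$ is induced by $\{\pi_r(s)\}\mapsto\{r\}$. -}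

module Defs where

open import Data.Integer using (ℤ; +_; -[1+_]; _+_; _*_; _-_; -_; 0ℤ; 1ℤ)
open import Data.Integer.Properties using (i-j≡0⇒i≡j; *-zeroʳ; *-identityˡ)
import Data.Integer.Properties as ℤP
open import Data.Integer.Solver using (module +-*-Solver)
open import Data.Rational using (ℚ; ↥_; ↧_)
open import Data.Product using (_×_; _,_; proj₁; proj₂; Σ; ∃)
open import Data.Sum using (_⊎_; inj₁; inj₂)
open import Data.Unit using (⊤; tt)
open import Data.List using (List; []; _∷_; map; concatMap; foldr)
open import Relation.Nullary using (¬_; Dec; yes; no)
open import Relation.Nullary.Decidable using (_×-dec_)
open import Relation.Binary.PropositionalEquality
  using (_≡_; refl; sym; trans; cong; cong₂)
open import Data.Empty using (⊥)

-- P¹(ℚ) via homogeneous coordinates: a point is a nonzero pair (x , y) ∈ ℤ²,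
-- and two pairs represent the same point iff x*y' ≡ x'*y.

Vec2 : Set
Vec2 = ℤ × ℤ

_∼_ : Vec2 → Vec2 → Set
(x , y) ∼ (x' , y') = x * y' ≡ x' * y

_∼?_ : (u v : Vec2) → Dec (u ∼ v)
(x , y) ∼? (x' , y') = (x * y') ℤP.≟ (x' * y)

record P1 : Set where
  constructor pt
  field
    vec     : Vec2
    nonzero : ¬ ((proj₁ vec ≡ 0ℤ) × (proj₂ vec ≡ 0ℤ))
open P1 public

∞v 0v : Vec2
∞v = (1ℤ , 0ℤ)
0v = (0ℤ , 1ℤ)

ℚv : ℚ → Vec2
ℚv t = (↥ t , ↧ t)

-- SL₂(ℤ), acting on ℤ² linearly, hence on P¹(ℚ) by Möbius transformations
-- γ = (a b ; c d) sends t ↦ (a t + b)/(c t + d).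

record SL2Z : Set where
  field
    a b c d : ℤ
    det     : a * d - b * c ≡ 1ℤ
open SL2Z public

act : SL2Z → Vec2 → Vec2
act γ (x , y) = (a γ * x + b γ * y , c γ * x + d γ * y)

private
  open +-*-Solver
  key : ∀ a b c d x y x' y' →
        (a * x + b * y) * (c * x' + d * y') - (a * x' + b * y') * (c * x + d * y)
        ≡ (a * d - b * c) * (x * y' - x' * y)
  key = solve 8 (λ a b c d x y x' y' →
        (a :* x :+ b :* y) :* (c :* x' :+ d :* y') :- (a :* x' :+ b :* y') :* (c :* x :+ d :* y)
        := (a :* d :- b :* c) :* (x :* y' :- x' :* y)) refl

act-reflects-∼ : ∀ γ u v → act γ u ∼ act γ v → u ∼ v
act-reflects-∼ γ (x , y) (x' , y') eq =
  i-j≡0⇒i≡j (x * y') (x' * y)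
    (trans (sym (*-identityˡ (x * y' - x' * y)))
    (trans (cong (_* (x * y' - x' * y)) (sym (det γ)))
    (trans (sym (key (a γ) (b γ) (c γ) (d γ) x y x' y'))
           (ℤP.i≡j⇒i-j≡0 eq))))

-- 𝒫(ℚ): formal symbols π_r(s) with r ≠ s in P¹(ℚ).
-- (r ≁ s forces both r and s to be nonzero pairs, since (0,0) ∼ everything.)

record Sym : Set where
  constructor π
  field
    base dir : Vec2
    distinct : ¬ (base ∼ dir)
open Sym public

actSym : SL2Z → Sym → Sym
actSym γ (π r s ne) = π (act γ r) (act γ s) (λ e → ne (act-reflects-∼ γ r s e))

_≈Sym_ : Sym → Sym → Set
σ ≈Sym τ = (base σ ∼ base τ) × (dir σ ∼ dir τ)

_≈Sym?_ : (σ τ : Sym) → Dec (σ ≈Sym τ)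
σ ≈Sym? τ = (base σ ∼? base τ) ×-dec (dir σ ∼? dir τ)

-- Ξ = free abelian group on 𝒫(ℚ): formal finite ℤ-combinations,
-- compared through their coefficient functions.

Ξ : Set
Ξ = List (ℤ × Sym)

coeff : Ξ → Sym → ℤ
coeff []             τ = 0ℤ
coeff ((n , σ) ∷ xs) τ with σ ≈Sym? τ
... | yes _ = n + coeff xs τ
... | no  _ = coeff xs τ

_≈Ξ_ : Ξ → Ξ → Set
x ≈Ξ y = ∀ τ → coeff x τ ≡ coeff y τ

actΞ : SL2Z → Ξ → Ξ
actΞ γ = map (λ { (n , σ) → (n , actSym γ σ) })

scaleΞ : ℤ → Ξ → Ξ
scaleΞ m = map (λ { (n , σ) → (m * n , σ) })

deg : Ξ → ℤ
deg = foldr (λ { (n , _) acc → n + acc }) 0ℤ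

InΞ₀ : Ξ → Set
InΞ₀ x = deg x ≡ 0ℤ

-- ∂ : Ξ → Δ = ℤ[P¹(ℚ)], π_r(s) ↦ r ; coefficient of ∂x at a point p
∂coeff : Ξ → Vec2 → ℤ
∂coeff []             p = 0ℤ
∂coeff ((n , σ) ∷ xs) p with base σ ∼? p
... | yes _ = n + ∂coeff xs p
... | no  _ = ∂coeff xs p

InW : Ξ → Set
InW x = ∀ (p : P1) → ∂coeff x (vec p) ≡ 0ℤ

combo : {I : Set} → (I → Ξ) → List (ℤ × SL2Z × I) → Ξ
combo g = concatMap (λ { (n , γ , i) → scaleΞ n (actΞ γ (g i)) })

InSpan : {I : Set} → (I → Ξ) → Ξ → Set
InSpan {I} g x = Σ (List (ℤ × SL2Z × I)) (λ L → combo g L ≈Ξ x)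

bracket : Sym → Sym → Ξ
bracket c₁ c₂ = (1ℤ , c₂) ∷ (-[1+ 0 ] , c₁) ∷ []

private
  ∞≁0 : ¬ (∞v ∼ 0v)
  ∞≁0 ()
  0≁∞ : ¬ (0v ∼ ∞v)
  0≁∞ ()
  ∞≁t : ∀ t → ¬ (∞v ∼ ℚv t)
  ∞≁t t e with trans e (*-zeroʳ (↥ t))
  ... | ()

-- modular symbol {∞,0} = [π_∞(0), π_0(∞)]
modSym∞0 : Ξ
modSym∞0 = bracket (π ∞v 0v ∞≁0) (π 0v ∞v 0≁∞)

-- infinitesimal symbol [0,t]_∞ = [π_∞(0), π_∞(t)]
infSym : ℚ → Ξ
infSym t = bracket (π ∞v 0v ∞≁0) (π ∞v (ℚv t) (∞≁t t))

gens₁ : ⊤ ⊎ ℚ → Ξ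
gens₁ (inj₁ _) = modSym∞0
gens₁ (inj₂ t) = infSym t

gens₂ : ℚ → Ξ
gens₂ = infSym

-- Call σ, τ ∈ 𝒫(ℚ) linked when [σ, τ] lies in the submodule S spanned by the generators.
-- Linking is an equivalence relation, and every SL₂(ℤ)-translate of a generator links its
-- two endpoints. SL₂(ℤ) acts transitively on P¹(ℚ), so any r is γ∞ for some γ, and the
-- translates γ[0,t]_∞ link π_{γ∞}(γ0) to every symbol based at r: any two symbols with the
-- same base are linked. The translate γ{∞,0} links π_{γ∞}(γ0) to π_{γ0}(γ∞); alternating
-- the two moves runs Euclid's algorithm on the bottom row of γ and links every symbol to
-- π_∞(0).
-- For any anchor map a with a(σ) linked to σ, Σ nᵢ{σᵢ} = Σ nᵢ[a(σᵢ), σᵢ] + Σ nᵢ{a(σᵢ)},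
-- and the first sum lies in S. For a ≡ π_∞(0) the second sum is deg(x)·{π_∞(0)}; for
-- a(σ) = π_r(a canonical direction at r), r the base of σ, its coefficients are those of ∂x.
-- Conversely, deg and ∂ are linear extensions of functions on 𝒫(ℚ) that take the same value
-- at both ends of every generator translate, so they vanish on S.

module Submission where

open import Defs
open import Data.Bool using (if_then_else_)
open import Data.Empty using (⊥-elim)
import Data.Integer as ℤ
open import Data.Integer using (ℤ; -[1+_]; _+_; _*_; _-_; -_; 0ℤ; 1ℤ; -1ℤ; ∣_∣)
open import Data.Integer.Base using (≢-nonZero; _/_; _%_)
import Data.Integer.Properties as ℤP
open import Data.Integer.DivMod using (a≡a%n+[a/n]*n; n%d<d)
open import Data.Integer.Solver using (module +-*-Solver)
open import Data.List using (List; []; _∷_; _++_; map; concatMap; filter; length)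
open import Data.List.Properties using (concatMap-++; filter-accept; filter-reject; length-filter)
open import Data.Nat as ℕ using (zero; suc; s≤s)
import Data.Nat.Properties as ℕP
open import Data.Product using (_×_; _,_; proj₁; proj₂; Σ)
open import Data.Rational using (ℚ; ↥_; ↧_; mkℚ; fromℚᵘ; toℚᵘ)
open import Data.Rational.Properties using (toℚᵘ-fromℚᵘ)
open import Data.Rational.Unnormalised as ℚᵘ using (mkℚᵘ; *≡*)
open import Data.Sum using (inj₁; inj₂)
open import Data.Unit using (tt)
open import Function using (_∘_)
open import Relation.Binary.Core using (_Preserves_⟶_)
open import Relation.Binary.PropositionalEquality
open import Relation.Nullary using (¬_; Dec; yes; no; does; ¬?)
open +-*-Solver using (solve; con; _:+_; _:-_; _:*_; :-_; _:=_)
open ≡-Reasoning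

-- Points of P¹(ℚ) and symbols

Nonzero : Vec2 → Set
Nonzero u = ¬ ((proj₁ u ≡ 0ℤ) × (proj₂ u ≡ 0ℤ))

∼-refl : ∀ {u} → u ∼ u
∼-refl = refl

≡⇒∼ : ∀ {u v} → u ≡ v → u ∼ v
≡⇒∼ refl = refl

zero-∼ : ∀ {u} v → proj₁ u ≡ 0ℤ → proj₂ u ≡ 0ℤ → u ∼ v
zero-∼ (x' , y') refl refl = trans (ℤP.*-zeroˡ y') (sym (ℤP.*-zeroʳ x'))

annihilated-by-nonzero : ∀ {z x y} → Nonzero (x , y) → z * y ≡ 0ℤ → z * x ≡ 0ℤ → z ≡ 0ℤ
annihilated-by-nonzero {z} nz zy≡0 zx≡0
  with ℤP.i*j≡0⇒i≡0∨j≡0 z zy≡0 | ℤP.i*j≡0⇒i≡0∨j≡0 z zx≡0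
... | inj₁ z≡0 | _        = z≡0
... | inj₂ _   | inj₁ z≡0 = z≡0
... | inj₂ y≡0 | inj₂ x≡0 = ⊥-elim (nz (x≡0 , y≡0))

-- The determinant x y'' − x'' y is killed by both coordinates of the middle vector.
∼-trans : ∀ {u v w} → Nonzero v → u ∼ v → v ∼ w → u ∼ w
∼-trans {x , y} {x' , y'} {x'' , y''} v≢0 e₁ e₂ =
  ℤP.i-j≡0⇒i≡j _ _ (annihilated-by-nonzero v≢0 killed-by-y' killed-by-x')
  where
  h₁ : x * y' - x' * y ≡ 0ℤ
  h₁ = ℤP.i≡j⇒i-j≡0 e₁
  h₂ : x' * y'' - x'' * y' ≡ 0ℤ
  h₂ = ℤP.i≡j⇒i-j≡0 e₂
  killed-by-y' : (x * y'' - x'' * y) * y' ≡ 0ℤ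
  killed-by-y' = begin
    (x * y'' - x'' * y) * y'
      ≡⟨ solve 6 (λ x y x' y' x'' y'' → (x :* y'' :- x'' :* y) :* y'
                   := y'' :* (x :* y' :- x' :* y) :+ y :* (x' :* y'' :- x'' :* y'))
               refl x y x' y' x'' y'' ⟩
    y'' * (x * y' - x' * y) + y * (x' * y'' - x'' * y')
      ≡⟨ cong₂ (λ p q → y'' * p + y * q) h₁ h₂ ⟩
    y'' * 0ℤ + y * 0ℤ
      ≡⟨ cong₂ _+_ (ℤP.*-zeroʳ y'') (ℤP.*-zeroʳ y) ⟩
    0ℤ ∎
  killed-by-x' : (x * y'' - x'' * y) * x' ≡ 0ℤ
  killed-by-x' = begin
    (x * y'' - x'' * y) * x'
      ≡⟨ solve 6 (λ x y x' y' x'' y'' → (x :* y'' :- x'' :* y) :* x'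
                   := x :* (x' :* y'' :- x'' :* y') :+ x'' :* (x :* y' :- x' :* y))
               refl x y x' y' x'' y'' ⟩
    x * (x' * y'' - x'' * y') + x'' * (x * y' - x' * y)
      ≡⟨ cong₂ (λ p q → x * p + x'' * q) h₂ h₁ ⟩
    x * 0ℤ + x'' * 0ℤ
      ≡⟨ cong₂ _+_ (ℤP.*-zeroʳ x) (ℤP.*-zeroʳ x'') ⟩
    0ℤ ∎

act-resp-∼ : ∀ γ {u v} → u ∼ v → act γ u ∼ act γ v
act-resp-∼ γ {x , y} {x' , y'} e = ℤP.i-j≡0⇒i≡j _ _ (begin
  (a γ * x + b γ * y) * (c γ * x' + d γ * y') - (a γ * x' + b γ * y') * (c γ * x + d γ * y)
    ≡⟨ solve 8 (λ a b c d x y x' y' →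
         (a :* x :+ b :* y) :* (c :* x' :+ d :* y') :- (a :* x' :+ b :* y') :* (c :* x :+ d :* y)
         := (a :* d :- b :* c) :* (x :* y' :- x' :* y))
       refl (a γ) (b γ) (c γ) (d γ) x y x' y' ⟩
  (a γ * d γ - b γ * c γ) * (x * y' - x' * y)
    ≡⟨ cong₂ _*_ (det γ) (ℤP.i≡j⇒i-j≡0 e) ⟩
  1ℤ * 0ℤ ∎)

nonzero-base : ∀ σ → Nonzero (base σ)
nonzero-base σ (x≡0 , y≡0) = distinct σ (zero-∼ (dir σ) x≡0 y≡0)

nonzero-dir : ∀ σ → Nonzero (dir σ)
nonzero-dir σ (x≡0 , y≡0) = distinct σ (sym (zero-∼ (base σ) x≡0 y≡0))

≈Sym-refl : ∀ {σ} → σ ≈Sym σ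
≈Sym-refl = refl , refl

≈Sym-sym : ∀ {σ τ} → σ ≈Sym τ → τ ≈Sym σ
≈Sym-sym (e₁ , e₂) = sym e₁ , sym e₂

≈Sym-trans : ∀ {σ τ ρ} → σ ≈Sym τ → τ ≈Sym ρ → σ ≈Sym ρ
≈Sym-trans {σ} {τ} {ρ} (e₁ , e₂) (f₁ , f₂) =
  ∼-trans {base σ} {base τ} {base ρ} (nonzero-base τ) e₁ f₁ ,
  ∼-trans {dir σ} {dir τ} {dir ρ} (nonzero-dir τ) e₂ f₂

-- Coefficients and linear functionals on Ξ

coeff-∷-≈ : ∀ n σ xs τ → σ ≈Sym τ → coeff ((n , σ) ∷ xs) τ ≡ n + coeff xs τ
coeff-∷-≈ n σ xs τ σ≈τ with σ ≈Sym? τ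
... | yes _   = refl
... | no σ≉τ = ⊥-elim (σ≉τ σ≈τ)

coeff-∷-≉ : ∀ n σ xs τ → ¬ σ ≈Sym τ → coeff ((n , σ) ∷ xs) τ ≡ coeff xs τ
coeff-∷-≉ n σ xs τ σ≉τ with σ ≈Sym? τ
... | yes σ≈τ = ⊥-elim (σ≉τ σ≈τ)
... | no _    = refl

coeff-++ : ∀ x y τ → coeff (x ++ y) τ ≡ coeff x τ + coeff y τ
coeff-++ []             y τ = sym (ℤP.+-identityˡ _)
coeff-++ ((n , σ) ∷ xs) y τ with σ ≈Sym? τ
... | yes _ = trans (cong (n +_) (coeff-++ xs y τ)) (sym (ℤP.+-assoc n _ _))
... | no _  = coeff-++ xs y τ

coeff-scaleΞ : ∀ m x τ → coeff (scaleΞ m x) τ ≡ m * coeff x τ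
coeff-scaleΞ m []             τ = sym (ℤP.*-zeroʳ m)
coeff-scaleΞ m ((n , σ) ∷ xs) τ with σ ≈Sym? τ
... | yes _ = trans (cong (m * n +_) (coeff-scaleΞ m xs τ)) (sym (ℤP.*-distribˡ-+ m n _))
... | no _  = coeff-scaleΞ m xs τ

δ : Sym → Sym → ℤ
δ σ = coeff ((1ℤ , σ) ∷ [])

δ-cong : ∀ {σ σ'} τ → σ ≈Sym σ' → δ σ τ ≡ δ σ' τ
δ-cong {σ} {σ'} τ σ≈σ' with σ ≈Sym? τ | σ' ≈Sym? τ
... | yes _   | yes _    = refl
... | no _    | no _     = refl
... | yes σ≈τ | no σ'≉τ = ⊥-elim (σ'≉τ (≈Sym-trans {σ'} {σ} {τ} (≈Sym-sym {σ} {σ'} σ≈σ') σ≈τ))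
... | no σ≉τ  | yes σ'≈τ = ⊥-elim (σ≉τ (≈Sym-trans {σ} {σ'} {τ} σ≈σ' σ'≈τ))

coeff-∷ : ∀ n σ xs τ → coeff ((n , σ) ∷ xs) τ ≡ n * δ σ τ + coeff xs τ
coeff-∷ n σ xs τ with σ ≈Sym? τ
... | yes _ = cong (_+ coeff xs τ) (sym (ℤP.*-identityʳ n))
... | no _  = sym (trans (cong (_+ coeff xs τ) (ℤP.*-zeroʳ n)) (ℤP.+-identityˡ _))

coeff-bracket : ∀ σ τ ρ → coeff (bracket σ τ) ρ ≡ δ τ ρ - δ σ ρ
coeff-bracket σ τ ρ = begin
  coeff (bracket σ τ) ρ
    ≡⟨ coeff-∷ 1ℤ τ _ ρ ⟩
  1ℤ * δ τ ρ + coeff ((-1ℤ , σ) ∷ []) ρ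
    ≡⟨ cong (1ℤ * δ τ ρ +_) (coeff-∷ -1ℤ σ [] ρ) ⟩
  1ℤ * δ τ ρ + (-1ℤ * δ σ ρ + 0ℤ)
    ≡⟨ solve 2 (λ p q → con 1ℤ :* p :+ (con -1ℤ :* q :+ con 0ℤ) := p :- q) refl (δ τ ρ) (δ σ ρ) ⟩
  δ τ ρ - δ σ ρ ∎

linExt : (Sym → ℤ) → Ξ → ℤ
linExt w []             = 0ℤ
linExt w ((n , σ) ∷ xs) = n * w σ + linExt w xs

linExt-++ : ∀ w x y → linExt w (x ++ y) ≡ linExt w x + linExt w y
linExt-++ w []             y = sym (ℤP.+-identityˡ _)
linExt-++ w ((n , σ) ∷ xs) y =
  trans (cong (n * w σ +_) (linExt-++ w xs y)) (sym (ℤP.+-assoc (n * w σ) _ _))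

linExt-scaleΞ : ∀ w m x → linExt w (scaleΞ m x) ≡ m * linExt w x
linExt-scaleΞ w m []             = sym (ℤP.*-zeroʳ m)
linExt-scaleΞ w m ((n , σ) ∷ xs) =
  trans (cong₂ _+_ (ℤP.*-assoc m n (w σ)) (linExt-scaleΞ w m xs))
        (sym (ℤP.*-distribˡ-+ m _ _))

linExt-bracket : ∀ w σ τ → linExt w (bracket σ τ) ≡ w τ - w σ
linExt-bracket w σ τ =
  solve 2 (λ p q → con 1ℤ :* p :+ (con -1ℤ :* q :+ con 0ℤ) := p :- q) refl (w τ) (w σ)

linExt-bracket-null : ∀ w {σ τ} → w σ ≡ w τ → linExt w (bracket σ τ) ≡ 0ℤ
linExt-bracket-null w {σ} {τ} wσ≡wτ = begin
  linExt w (bracket σ τ) ≡⟨ linExt-bracket w σ τ ⟩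
  w τ - w σ              ≡⟨ cong (λ z → w τ - z) wσ≡wτ ⟩
  w τ - w τ              ≡⟨ ℤP.+-inverseʳ (w τ) ⟩
  0ℤ ∎

outside? : ∀ σ (t : ℤ × Sym) → Dec (¬ proj₂ t ≈Sym σ)
outside? σ t = ¬? (proj₂ t ≈Sym? σ)

removeClass : Sym → Ξ → Ξ
removeClass σ = filter (outside? σ)

removeClass-≈ : ∀ σ n ρ xs → ρ ≈Sym σ → removeClass σ ((n , ρ) ∷ xs) ≡ removeClass σ xs
removeClass-≈ σ n ρ xs ρ≈σ = filter-reject (outside? σ) {n , ρ} {xs} (λ ρ≉σ → ρ≉σ ρ≈σ)

removeClass-≉ : ∀ σ n ρ xs → ¬ ρ ≈Sym σ → removeClass σ ((n , ρ) ∷ xs) ≡ (n , ρ) ∷ removeClass σ xs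
removeClass-≉ σ n ρ xs ρ≉σ = filter-accept (outside? σ) {n , ρ} {xs} ρ≉σ

coeff-removeClass-≈ : ∀ σ τ x → σ ≈Sym τ → coeff (removeClass σ x) τ ≡ 0ℤ
coeff-removeClass-≈ σ τ [] σ≈τ = refl
coeff-removeClass-≈ σ τ ((n , ρ) ∷ xs) σ≈τ with ρ ≈Sym? σ
... | yes ρ≈σ = trans (cong (λ z → coeff z τ) (removeClass-≈ σ n ρ xs ρ≈σ)) (coeff-removeClass-≈ σ τ xs σ≈τ)
... | no ρ≉σ = begin
  coeff (removeClass σ ((n , ρ) ∷ xs)) τ ≡⟨ cong (λ z → coeff z τ) (removeClass-≉ σ n ρ xs ρ≉σ) ⟩
  coeff ((n , ρ) ∷ removeClass σ xs) τ   ≡⟨ coeff-∷-≉ n ρ _ τ ρ≉τ ⟩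
  coeff (removeClass σ xs) τ             ≡⟨ coeff-removeClass-≈ σ τ xs σ≈τ ⟩
  0ℤ ∎
  where
  ρ≉τ : ¬ ρ ≈Sym τ
  ρ≉τ ρ≈τ = ρ≉σ (≈Sym-trans {ρ} {τ} {σ} ρ≈τ (≈Sym-sym {σ} {τ} σ≈τ))

coeff-removeClass-≉ : ∀ σ τ x → ¬ σ ≈Sym τ → coeff (removeClass σ x) τ ≡ coeff x τ
coeff-removeClass-≉ σ τ [] σ≉τ = refl
coeff-removeClass-≉ σ τ ((n , ρ) ∷ xs) σ≉τ with ρ ≈Sym? σ
... | yes ρ≈σ = begin
  coeff (removeClass σ ((n , ρ) ∷ xs)) τ ≡⟨ cong (λ z → coeff z τ) (removeClass-≈ σ n ρ xs ρ≈σ) ⟩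
  coeff (removeClass σ xs) τ             ≡⟨ coeff-removeClass-≉ σ τ xs σ≉τ ⟩
  coeff xs τ                             ≡⟨ coeff-∷-≉ n ρ xs τ ρ≉τ ⟨
  coeff ((n , ρ) ∷ xs) τ ∎
  where
  ρ≉τ : ¬ ρ ≈Sym τ
  ρ≉τ ρ≈τ = σ≉τ (≈Sym-trans {σ} {ρ} {τ} (≈Sym-sym {ρ} {σ} ρ≈σ) ρ≈τ)
... | no ρ≉σ = begin
  coeff (removeClass σ ((n , ρ) ∷ xs)) τ ≡⟨ cong (λ z → coeff z τ) (removeClass-≉ σ n ρ xs ρ≉σ) ⟩
  coeff ((n , ρ) ∷ removeClass σ xs) τ   ≡⟨ coeff-∷ n ρ _ τ ⟩
  n * δ ρ τ + coeff (removeClass σ xs) τ ≡⟨ cong (n * δ ρ τ +_) (coeff-removeClass-≉ σ τ xs σ≉τ) ⟩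
  n * δ ρ τ + coeff xs τ                 ≡⟨ coeff-∷ n ρ xs τ ⟨
  coeff ((n , ρ) ∷ xs) τ ∎

module _ (w : Sym → ℤ) (w-cong : w Preserves _≈Sym_ ⟶ _≡_) where

  linExt-removeClass : ∀ σ x → linExt w x ≡ coeff x σ * w σ + linExt w (removeClass σ x)
  linExt-removeClass σ [] = refl
  linExt-removeClass σ ((n , ρ) ∷ xs) with ρ ≈Sym? σ
  ... | yes ρ≈σ = begin
    n * w ρ + linExt w xs
      ≡⟨ cong₂ (λ p q → n * p + q) (w-cong ρ≈σ) (linExt-removeClass σ xs) ⟩
    n * w σ + (coeff xs σ * w σ + linExt w (removeClass σ xs))
      ≡⟨ ℤP.+-assoc (n * w σ) _ _ ⟨
    n * w σ + coeff xs σ * w σ + linExt w (removeClass σ xs)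
      ≡⟨ cong (_+ linExt w (removeClass σ xs)) (ℤP.*-distribʳ-+ (w σ) n _) ⟨
    (n + coeff xs σ) * w σ + linExt w (removeClass σ xs)
      ≡⟨ cong (λ z → (n + coeff xs σ) * w σ + linExt w z) (removeClass-≈ σ n ρ xs ρ≈σ) ⟨
    (n + coeff xs σ) * w σ + linExt w (removeClass σ ((n , ρ) ∷ xs)) ∎
  ... | no ρ≉σ = begin
    n * w ρ + linExt w xs
      ≡⟨ cong (n * w ρ +_) (linExt-removeClass σ xs) ⟩
    n * w ρ + (coeff xs σ * w σ + linExt w (removeClass σ xs))
      ≡⟨ solve 3 (λ p q r → p :+ (q :+ r) := q :+ (p :+ r))
           refl (n * w ρ) (coeff xs σ * w σ) (linExt w (removeClass σ xs)) ⟩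
    coeff xs σ * w σ + linExt w ((n , ρ) ∷ removeClass σ xs)
      ≡⟨ cong (λ z → coeff xs σ * w σ + linExt w z) (removeClass-≉ σ n ρ xs ρ≉σ) ⟨
    coeff xs σ * w σ + linExt w (removeClass σ ((n , ρ) ∷ xs)) ∎

  -- Induction on length: removing the class of the head symbol keeps all coefficients zero.
  linExt-null : ∀ x → (∀ τ → coeff x τ ≡ 0ℤ) → linExt w x ≡ 0ℤ
  linExt-null x = go (length x) x ℕP.≤-refl
    where
    go : ∀ k x → length x ℕ.≤ k → (∀ τ → coeff x τ ≡ 0ℤ) → linExt w x ≡ 0ℤ
    go _       []                 _         _    = refl
    go (suc k) x@((_ , σ) ∷ xs) (s≤s len) null = begin
      linExt w x
        ≡⟨ linExt-removeClass σ x ⟩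
      coeff x σ * w σ + linExt w (removeClass σ x)
        ≡⟨ cong₂ _+_ (cong (_* w σ) (null σ)) (go k (removeClass σ x) shorter rest-null) ⟩
      0ℤ ∎
      where
      shorter : length (removeClass σ x) ℕ.≤ k
      shorter = subst (λ z → length z ℕ.≤ k) (sym (removeClass-≈ σ _ σ xs (≈Sym-refl {σ})))
                      (ℕP.≤-trans (length-filter (outside? σ) xs) len)
      rest-null : ∀ τ → coeff (removeClass σ x) τ ≡ 0ℤ
      rest-null τ with σ ≈Sym? τ
      ... | yes σ≈τ = coeff-removeClass-≈ σ τ x σ≈τ
      ... | no σ≉τ  = trans (coeff-removeClass-≉ σ τ x σ≉τ) (null τ)

  linExt-cong : ∀ {x y} → x ≈Ξ y → linExt w x ≡ linExt w y
  linExt-cong {x} {y} x≈y = ℤP.i-j≡0⇒i≡j _ _ (begin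
    linExt w x - linExt w y
      ≡⟨ cong (linExt w x +_) (ℤP.-1*i≡-i (linExt w y)) ⟨
    linExt w x + -1ℤ * linExt w y
      ≡⟨ cong (linExt w x +_) (linExt-scaleΞ w -1ℤ y) ⟨
    linExt w x + linExt w (scaleΞ -1ℤ y)
      ≡⟨ linExt-++ w x (scaleΞ -1ℤ y) ⟨
    linExt w (x ++ scaleΞ -1ℤ y)
      ≡⟨ linExt-null (x ++ scaleΞ -1ℤ y) cancels ⟩
    0ℤ ∎)
    where
    cancels : ∀ τ → coeff (x ++ scaleΞ -1ℤ y) τ ≡ 0ℤ
    cancels τ = begin
      coeff (x ++ scaleΞ -1ℤ y) τ       ≡⟨ coeff-++ x _ τ ⟩
      coeff x τ + coeff (scaleΞ -1ℤ y) τ ≡⟨ cong₂ _+_ (x≈y τ) (coeff-scaleΞ -1ℤ y τ) ⟩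
      coeff y τ + -1ℤ * coeff y τ       ≡⟨ cong (coeff y τ +_) (ℤP.-1*i≡-i (coeff y τ)) ⟩
      coeff y τ - coeff y τ             ≡⟨ ℤP.+-inverseʳ (coeff y τ) ⟩
      0ℤ ∎

deg≡linExt-1 : ∀ x → deg x ≡ linExt (λ _ → 1ℤ) x
deg≡linExt-1 []             = refl
deg≡linExt-1 ((n , σ) ∷ xs) = cong₂ _+_ (sym (ℤP.*-identityʳ n)) (deg≡linExt-1 xs)

pointIndicator : Vec2 → Vec2 → ℤ
pointIndicator p r = if does (r ∼? p) then 1ℤ else 0ℤ

atBase : Vec2 → Sym → ℤ
atBase p σ = pointIndicator p (base σ)

atBase-cong : ∀ p → atBase p Preserves _≈Sym_ ⟶ _≡_
atBase-cong p {σ} {τ} (σ∼τ , _) with base σ ∼? p | base τ ∼? p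
... | yes _   | yes _   = refl
... | no _    | no _    = refl
... | yes σ∼p | no τ≁p = ⊥-elim (τ≁p (∼-trans {base τ} {base σ} {p} (nonzero-base σ) (sym σ∼τ) σ∼p))
... | no σ≁p  | yes τ∼p = ⊥-elim (σ≁p (∼-trans {base σ} {base τ} {p} (nonzero-base τ) σ∼τ τ∼p))

∂coeff≡linExt-atBase : ∀ p x → ∂coeff x p ≡ linExt (atBase p) x
∂coeff≡linExt-atBase p []             = refl
∂coeff≡linExt-atBase p ((n , σ) ∷ xs) with base σ ∼? p
... | yes _ = cong₂ _+_ (sym (ℤP.*-identityʳ n)) (∂coeff≡linExt-atBase p xs)
... | no _  = begin
  ∂coeff xs p                     ≡⟨ ∂coeff≡linExt-atBase p xs ⟩
  linExt (atBase p) xs            ≡⟨ ℤP.+-identityˡ _ ⟨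
  0ℤ + linExt (atBase p) xs       ≡⟨ cong (_+ linExt (atBase p) xs) (ℤP.*-zeroʳ n) ⟨
  n * 0ℤ + linExt (atBase p) xs ∎

relabel : (Sym → Sym) → Ξ → Ξ
relabel a = map (λ { (n , σ) → (n , a σ) })

anchoredBrackets : (Sym → Sym) → Ξ → Ξ
anchoredBrackets a = concatMap (λ { (n , σ) → scaleΞ n (bracket (a σ) σ) })

coeff-anchored-decomposition : ∀ a x τ →
  coeff x τ ≡ coeff (anchoredBrackets a x) τ + coeff (relabel a x) τ
coeff-anchored-decomposition a []             τ = refl
coeff-anchored-decomposition a ((n , σ) ∷ xs) τ = begin
  coeff ((n , σ) ∷ xs) τ
    ≡⟨ coeff-∷ n σ xs τ ⟩
  n * δ σ τ + coeff xs τ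
    ≡⟨ cong (n * δ σ τ +_) (coeff-anchored-decomposition a xs τ) ⟩
  n * δ σ τ + (coeff (anchoredBrackets a xs) τ + coeff (relabel a xs) τ)
    ≡⟨ solve 5 (λ n s a B R → n :* s :+ (B :+ R) := n :* (s :- a) :+ B :+ (n :* a :+ R))
         refl n (δ σ τ) (δ (a σ) τ) (coeff (anchoredBrackets a xs) τ) (coeff (relabel a xs) τ) ⟩
  n * (δ σ τ - δ (a σ) τ) + coeff (anchoredBrackets a xs) τ + (n * δ (a σ) τ + coeff (relabel a xs) τ)
    ≡⟨ cong₂ _+_ (cong (_+ coeff (anchoredBrackets a xs) τ) bracket-part)
                 (coeff-∷ n (a σ) (relabel a xs) τ) ⟨
  coeff (scaleΞ n (bracket (a σ) σ)) τ + coeff (anchoredBrackets a xs) τ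
    + coeff (relabel a ((n , σ) ∷ xs)) τ
    ≡⟨ cong (_+ coeff (relabel a ((n , σ) ∷ xs)) τ) (coeff-++ (scaleΞ n (bracket (a σ) σ)) _ τ) ⟨
  coeff (anchoredBrackets a ((n , σ) ∷ xs)) τ + coeff (relabel a ((n , σ) ∷ xs)) τ ∎
  where
  bracket-part : coeff (scaleΞ n (bracket (a σ) σ)) τ ≡ n * (δ σ τ - δ (a σ) τ)
  bracket-part = trans (coeff-scaleΞ n (bracket (a σ) σ) τ) (cong (n *_) (coeff-bracket (a σ) σ τ))

coeff-relabel-absent : ∀ a τ → (∀ σ → ¬ a σ ≈Sym τ) → ∀ x → coeff (relabel a x) τ ≡ 0ℤ
coeff-relabel-absent a τ absent []             = refl
coeff-relabel-absent a τ absent ((n , σ) ∷ xs) =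
  trans (coeff-∷-≉ n (a σ) (relabel a xs) τ (absent σ)) (coeff-relabel-absent a τ absent xs)

coeff-relabel-const : ∀ ρ τ → ρ ≈Sym τ → ∀ x → coeff (relabel (λ _ → ρ) x) τ ≡ deg x
coeff-relabel-const ρ τ ρ≈τ []             = refl
coeff-relabel-const ρ τ ρ≈τ ((n , σ) ∷ xs) =
  trans (coeff-∷-≈ n ρ _ τ ρ≈τ) (cong (n +_) (coeff-relabel-const ρ τ ρ≈τ xs))

coeff-relabel-∂ : ∀ a τ p → (∀ σ → base σ ∼ p → a σ ≈Sym τ) → (∀ σ → a σ ≈Sym τ → base σ ∼ p) →
                  ∀ x → coeff (relabel a x) τ ≡ ∂coeff x p
coeff-relabel-∂ a τ p to from []             = refl
coeff-relabel-∂ a τ p to from ((n , σ) ∷ xs) with base σ ∼? p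
... | yes σ∼p = trans (coeff-∷-≈ n (a σ) _ τ (to σ σ∼p)) (cong (n +_) (coeff-relabel-∂ a τ p to from xs))
... | no σ≁p  = trans (coeff-∷-≉ n (a σ) _ τ (λ e → σ≁p (from σ e))) (coeff-relabel-∂ a τ p to from xs)

-- Submodules generated by a family

module Span {I : Set} (g : I → Ξ) where

  span-≈ : ∀ x y → InSpan g x → x ≈Ξ y → InSpan g y
  span-≈ x y (L , e) x≈y = L , λ τ → trans (e τ) (x≈y τ)

  span-[] : InSpan g []
  span-[] = [] , λ _ → refl

  span-gen : ∀ γ i → InSpan g (actΞ γ (g i))
  span-gen γ i = (1ℤ , γ , i) ∷ [] , λ τ → begin
    coeff (scaleΞ 1ℤ (actΞ γ (g i)) ++ []) τ   ≡⟨ coeff-++ (scaleΞ 1ℤ (actΞ γ (g i))) [] τ ⟩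
    coeff (scaleΞ 1ℤ (actΞ γ (g i))) τ + 0ℤ    ≡⟨ ℤP.+-identityʳ _ ⟩
    coeff (scaleΞ 1ℤ (actΞ γ (g i))) τ         ≡⟨ coeff-scaleΞ 1ℤ (actΞ γ (g i)) τ ⟩
    1ℤ * coeff (actΞ γ (g i)) τ                ≡⟨ ℤP.*-identityˡ _ ⟩
    coeff (actΞ γ (g i)) τ ∎

  span-++ : ∀ x y → InSpan g x → InSpan g y → InSpan g (x ++ y)
  span-++ x y (L₁ , e₁) (L₂ , e₂) = L₁ ++ L₂ , λ τ → begin
    coeff (combo g (L₁ ++ L₂)) τ                ≡⟨ cong (λ z → coeff z τ) (concatMap-++ _ L₁ L₂) ⟩
    coeff (combo g L₁ ++ combo g L₂) τ          ≡⟨ coeff-++ (combo g L₁) _ τ ⟩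
    coeff (combo g L₁) τ + coeff (combo g L₂) τ ≡⟨ cong₂ _+_ (e₁ τ) (e₂ τ) ⟩
    coeff x τ + coeff y τ                       ≡⟨ coeff-++ x y τ ⟨
    coeff (x ++ y) τ ∎

  span-scaleΞ : ∀ m x → InSpan g x → InSpan g (scaleΞ m x)
  span-scaleΞ m x (L , e) = rescale L , λ τ → begin
    coeff (combo g (rescale L)) τ ≡⟨ coeff-combo-rescale L τ ⟩
    m * coeff (combo g L) τ       ≡⟨ cong (m *_) (e τ) ⟩
    m * coeff x τ                 ≡⟨ coeff-scaleΞ m x τ ⟨
    coeff (scaleΞ m x) τ ∎
    where
    rescale : List (ℤ × SL2Z × I) → List (ℤ × SL2Z × I)
    rescale = map (λ { (n , γ , i) → (m * n , γ , i) })
    coeff-combo-rescale : ∀ L τ → coeff (combo g (rescale L)) τ ≡ m * coeff (combo g L) τ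
    coeff-combo-rescale []                τ = sym (ℤP.*-zeroʳ m)
    coeff-combo-rescale ((n , γ , i) ∷ L) τ = begin
      coeff (scaleΞ (m * n) A ++ combo g (rescale L)) τ
        ≡⟨ coeff-++ (scaleΞ (m * n) A) _ τ ⟩
      coeff (scaleΞ (m * n) A) τ + coeff (combo g (rescale L)) τ
        ≡⟨ cong₂ _+_ (coeff-scaleΞ (m * n) A τ) (coeff-combo-rescale L τ) ⟩
      m * n * coeff A τ + m * coeff (combo g L) τ
        ≡⟨ solve 4 (λ m n a r → m :* n :* a :+ m :* r := m :* (n :* a :+ r))
             refl m n (coeff A τ) (coeff (combo g L) τ) ⟩
      m * (n * coeff A τ + coeff (combo g L) τ)
        ≡⟨ cong (λ z → m * (z + coeff (combo g L) τ)) (coeff-scaleΞ n A τ) ⟨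
      m * (coeff (scaleΞ n A) τ + coeff (combo g L) τ)
        ≡⟨ cong (m *_) (coeff-++ (scaleΞ n A) _ τ) ⟨
      m * coeff (scaleΞ n A ++ combo g L) τ ∎
      where
      A = actΞ γ (g i)

  linExt-span : ∀ w → w Preserves _≈Sym_ ⟶ _≡_ → (∀ γ i → linExt w (actΞ γ (g i)) ≡ 0ℤ) →
                ∀ x → InSpan g x → linExt w x ≡ 0ℤ
  linExt-span w w-cong gens-null x (L , e) = trans (sym (linExt-cong w w-cong {combo g L} {x} e)) (combo-null L)
    where
    combo-null : ∀ L → linExt w (combo g L) ≡ 0ℤ
    combo-null []                = refl
    combo-null ((n , γ , i) ∷ L) = begin
      linExt w (scaleΞ n (actΞ γ (g i)) ++ combo g L)
        ≡⟨ linExt-++ w (scaleΞ n (actΞ γ (g i))) _ ⟩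
      linExt w (scaleΞ n (actΞ γ (g i))) + linExt w (combo g L)
        ≡⟨ cong₂ _+_ (trans (linExt-scaleΞ w n (actΞ γ (g i))) (cong (n *_) (gens-null γ i))) (combo-null L) ⟩
      n * 0ℤ + 0ℤ
        ≡⟨ trans (ℤP.+-identityʳ _) (ℤP.*-zeroʳ n) ⟩
      0ℤ ∎

  -- A record, so that the two symbols can be inferred from a proof.
  record Linked (σ τ : Sym) : Set where
    constructor linked
    field bracket∈span : InSpan g (bracket σ τ)
  open Linked public

  ≈⇒linked : ∀ {σ τ} → σ ≈Sym τ → Linked σ τ
  ≈⇒linked {σ} {τ} σ≈τ = linked (span-≈ [] (bracket σ τ) span-[] λ ρ → sym (begin
    coeff (bracket σ τ) ρ ≡⟨ coeff-bracket σ τ ρ ⟩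
    δ τ ρ - δ σ ρ         ≡⟨ cong (_- δ σ ρ) (δ-cong {τ} {σ} ρ (≈Sym-sym {σ} {τ} σ≈τ)) ⟩
    δ σ ρ - δ σ ρ         ≡⟨ ℤP.+-inverseʳ (δ σ ρ) ⟩
    0ℤ ∎))

  linked-sym : ∀ {σ τ} → Linked σ τ → Linked τ σ
  linked-sym {σ} {τ} (linked l) =
    linked (span-≈ (scaleΞ -1ℤ (bracket σ τ)) (bracket τ σ) (span-scaleΞ -1ℤ (bracket σ τ) l) λ ρ → begin
      coeff (scaleΞ -1ℤ (bracket σ τ)) ρ ≡⟨ coeff-scaleΞ -1ℤ (bracket σ τ) ρ ⟩
      -1ℤ * coeff (bracket σ τ) ρ        ≡⟨ cong (-1ℤ *_) (coeff-bracket σ τ ρ) ⟩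
      -1ℤ * (δ τ ρ - δ σ ρ)              ≡⟨ solve 2 (λ p q → con -1ℤ :* (p :- q) := q :- p)
                                              refl (δ τ ρ) (δ σ ρ) ⟩
      δ σ ρ - δ τ ρ                      ≡⟨ coeff-bracket τ σ ρ ⟨
      coeff (bracket τ σ) ρ ∎)

  linked-trans : ∀ {σ τ ρ} → Linked σ τ → Linked τ ρ → Linked σ ρ
  linked-trans {σ} {τ} {ρ} (linked l₁) (linked l₂) =
    linked (span-≈ (bracket σ τ ++ bracket τ ρ) (bracket σ ρ) (span-++ (bracket σ τ) (bracket τ ρ) l₁ l₂) λ κ → begin
      coeff (bracket σ τ ++ bracket τ ρ) κ          ≡⟨ coeff-++ (bracket σ τ) _ κ ⟩
      coeff (bracket σ τ) κ + coeff (bracket τ ρ) κ ≡⟨ cong₂ _+_ (coeff-bracket σ τ κ) (coeff-bracket τ ρ κ) ⟩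
      (δ τ κ - δ σ κ) + (δ ρ κ - δ τ κ)             ≡⟨ solve 3 (λ s t r → (t :- s) :+ (r :- t) := r :- s)
                                                         refl (δ σ κ) (δ τ κ) (δ ρ κ) ⟩
      δ ρ κ - δ σ κ                                 ≡⟨ coeff-bracket σ ρ κ ⟨
      coeff (bracket σ ρ) κ ∎)

  linked-resp : ∀ {σ τ σ' τ'} → Linked σ τ → σ ≈Sym σ' → τ ≈Sym τ' → Linked σ' τ'
  linked-resp {σ} {τ} {σ'} {τ'} l σ≈σ' τ≈τ' =
    linked-trans (≈⇒linked {σ'} {σ} (≈Sym-sym {σ} {σ'} σ≈σ')) (linked-trans l (≈⇒linked {τ} {τ'} τ≈τ'))

  linked-gen : ∀ γ i {σ τ} → g i ≡ bracket σ τ → Linked (actSym γ σ) (actSym γ τ)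
  linked-gen γ i e = linked (subst (InSpan g) (cong (actΞ γ) e) (span-gen γ i))

  anchoredBrackets-span : ∀ {a} → (∀ σ → Linked (a σ) σ) → ∀ x → InSpan g (anchoredBrackets a x)
  anchoredBrackets-span link []             = span-[]
  anchoredBrackets-span {a} link ((n , σ) ∷ xs) =
    span-++ (scaleΞ n (bracket (a σ) σ)) (anchoredBrackets a xs)
      (span-scaleΞ n (bracket (a σ) σ) (bracket∈span (link σ))) (anchoredBrackets-span link xs)

  span-of-null-relabel : ∀ {a} → (∀ σ → Linked (a σ) σ) →
                         ∀ x → (∀ τ → coeff (relabel a x) τ ≡ 0ℤ) → InSpan g x
  span-of-null-relabel {a} link x null = span-≈ (anchoredBrackets a x) x (anchoredBrackets-span link x) λ τ → begin
    coeff (anchoredBrackets a x) τ                         ≡⟨ ℤP.+-identityʳ _ ⟨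
    coeff (anchoredBrackets a x) τ + 0ℤ                    ≡⟨ cong (coeff (anchoredBrackets a x) τ +_) (null τ) ⟨
    coeff (anchoredBrackets a x) τ + coeff (relabel a x) τ ≡⟨ coeff-anchored-decomposition a x τ ⟨
    coeff x τ ∎

-- SL₂(ℤ) and its action on P¹(ℚ)

ℚv-fromℚᵘ : ∀ x n → ℚv (fromℚᵘ (mkℚᵘ x n)) ∼ (x , ℤ.+[1+ n ])
ℚv-fromℚᵘ x n = from-≃ (fromℚᵘ (mkℚᵘ x n)) (toℚᵘ-fromℚᵘ (mkℚᵘ x n))
  where
  from-≃ : ∀ t → toℚᵘ t ℚᵘ.≃ mkℚᵘ x n → ℚv t ∼ (x , ℤ.+[1+ n ])
  from-≃ (mkℚ _ _ _) (*≡* e) = e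

finitePoint : ∀ w → proj₂ w ≢ 0ℤ → Σ ℚ λ t → ℚv t ∼ w
finitePoint (x , ℤ.+[1+ n ]) _   = fromℚᵘ (mkℚᵘ x n) , ℚv-fromℚᵘ x n
finitePoint (x , ℤ.+0)       y≢0 = ⊥-elim (y≢0 refl)
finitePoint (x , -[1+ n ])   _   = t , (begin
  ↥ t * -[1+ n ]         ≡⟨ ℤP.neg-distribʳ-* (↥ t) ℤ.+[1+ n ] ⟨
  - (↥ t * ℤ.+[1+ n ])   ≡⟨ cong -_ (ℚv-fromℚᵘ (- x) n) ⟩
  - (- x * ↧ t)          ≡⟨ cong -_ (ℤP.neg-distribˡ-* x (↧ t)) ⟨
  - - (x * ↧ t)          ≡⟨ ℤP.neg-involutive (x * ↧ t) ⟩
  x * ↧ t ∎)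
  where t = fromℚᵘ (mkℚᵘ (- x) n)

col∞ col0 : SL2Z → Vec2
col∞ γ = (a γ , c γ)
col0 γ = (b γ , d γ)

act-∞v : ∀ γ → act γ ∞v ≡ col∞ γ
act-∞v γ = cong₂ _,_ (first (a γ) (b γ)) (first (c γ) (d γ))
  where first : ∀ p q → p * 1ℤ + q * 0ℤ ≡ p
        first p q = trans (cong₂ _+_ (ℤP.*-identityʳ p) (ℤP.*-zeroʳ q)) (ℤP.+-identityʳ p)

act-0v : ∀ γ → act γ 0v ≡ col0 γ
act-0v γ = cong₂ _,_ (second (a γ) (b γ)) (second (c γ) (d γ))
  where second : ∀ p q → p * 0ℤ + q * 1ℤ ≡ q
        second p q = trans (cong₂ _+_ (ℤP.*-zeroʳ p) (ℤP.*-identityʳ q)) (ℤP.+-identityˡ q)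

columns-distinct : ∀ γ → ¬ col∞ γ ∼ col0 γ
columns-distinct γ e with trans (sym (det γ)) (ℤP.i≡j⇒i-j≡0 e)
... | ()

colSym : SL2Z → Sym
colSym γ = π (col∞ γ) (col0 γ) (columns-distinct γ)

-- Euclid's algorithm on the column: γ = T^k S γ', where p = k q + p' and γ' ∞ ∼ (q , −p').
∞-orbit : ∀ r → Σ SL2Z λ γ → col∞ γ ∼ r
∞-orbit r = descend ∣ proj₂ r ∣ r ℕP.≤-refl
  where
  identity : SL2Z
  identity = record { a = 1ℤ ; b = 0ℤ ; c = 0ℤ ; d = 1ℤ ; det = refl }
  descend : ∀ n r → ∣ proj₂ r ∣ ℕ.≤ n → Σ SL2Z λ γ → col∞ γ ∼ r
  descend n (p , q) bound with q ℤP.≟ 0ℤ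
  ... | yes q≡0 = identity , trans (cong (1ℤ *_) q≡0) (sym (ℤP.*-zeroʳ p))
  descend zero    (p , q) bound | no q≢0 = ⊥-elim (q≢0 (ℤP.∣i∣≡0⇒i≡0 (ℕP.n≤0⇒n≡0 bound)))
  descend (suc n) (p , q) bound | no q≢0 = γ , col∞γ∼r
    where
    instance _ = ≢-nonZero q≢0
    k = p / q
    p' = ℤ.+ (p % q)
    smaller : ∣ - p' ∣ ℕ.≤ n
    smaller = ℕP.≤-trans (ℕP.≤-reflexive (ℤP.∣-i∣≡∣i∣ p')) (ℕP.≤-pred (ℕP.≤-trans (n%d<d p q) bound))
    γ' = proj₁ (descend n (q , - p') smaller)
    γ : SL2Z
    γ = record { a = - c γ' + k * a γ' ; b = - d γ' + k * b γ' ; c = a γ' ; d = b γ'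
               ; det = trans (solve 5 (λ a b c d k → (:- c :+ k :* a) :* b :- (:- d :+ k :* b) :* a
                                                  := a :* d :- b :* c)
                                    refl (a γ') (b γ') (c γ') (d γ') k)
                             (det γ') }
    col∞γ∼r : col∞ γ ∼ (p , q)
    col∞γ∼r = begin
      (- c γ' + k * a γ') * q
        ≡⟨ ℤP.i-j≡0⇒i≡j _ _ (trans
             (solve 5 (λ a c p' k q → (:- c :+ k :* a) :* q :- (p' :+ k :* q) :* a := a :* (:- p') :- q :* c)
                    refl (a γ') (c γ') p' k q)
             (ℤP.i≡j⇒i-j≡0 (proj₂ (descend n (q , - p') smaller)))) ⟩
      (p' + k * q) * a γ'
        ≡⟨ cong (_* a γ') (a≡a%n+[a/n]*n p q) ⟨
      p * a γ' ∎

π∞0 : Sym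
π∞0 = π ∞v 0v (λ ())

-- γ T^k and γ S, for T = (1 1; 0 1) and S = (0 −1; 1 0)
mulT : SL2Z → ℤ → SL2Z
mulT γ k = record { a = a γ ; b = a γ * k + b γ ; c = c γ ; d = c γ * k + d γ
                  ; det = trans (solve 5 (λ a b c d k → a :* (c :* k :+ d) :- (a :* k :+ b) :* c
                                                     := a :* d :- b :* c)
                                       refl (a γ) (b γ) (c γ) (d γ) k)
                                (det γ) }

mulS : SL2Z → SL2Z
mulS γ = record { a = b γ ; b = - a γ ; c = d γ ; d = - c γ
                ; det = trans (solve 4 (λ a b c d → b :* (:- c) :- (:- a) :* d := a :* d :- b :* c)
                                     refl (a γ) (b γ) (c γ) (d γ))
                              (det γ) }

-- Linking symbols through translates of the generators

module Generated {I : Set} (g : I → Ξ) (inf : ℚ → I) (g-inf : ∀ t → g (inf t) ≡ infSym t) where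

  open Span g

  -- γ⁻¹ ρ = π_∞(t) for some t ∈ ℚ, and γ [0,t]_∞ = [π_{γ∞}(γ0), π_{γ∞}(γt)].
  linked-colSym : ∀ γ {ρ} → col∞ γ ∼ base ρ → Linked (colSym γ) ρ
  linked-colSym γ {ρ} γ∞∼r = linked-resp (linked-gen γ (inf t) (g-inf t))
    (≡⇒∼ (act-∞v γ) , ≡⇒∼ (act-0v γ))
    (subst (_∼ base ρ) (sym (act-∞v γ)) γ∞∼r , subst (act γ (ℚv t) ∼_) γw≡s (act-resp-∼ γ t∼w))
    where
    x = proj₁ (dir ρ)
    y = proj₂ (dir ρ)
    w : Vec2
    w = (d γ * x - b γ * y , a γ * y - c γ * x)
    w₂≢0 : proj₂ w ≢ 0ℤ
    w₂≢0 w₂≡0 = distinct ρ (∼-trans {base ρ} {col∞ γ} {dir ρ} (nonzero-base (colSym γ)) (sym γ∞∼r)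
                  (trans (ℤP.i-j≡0⇒i≡j _ _ w₂≡0) (ℤP.*-comm (c γ) x)))
    t = proj₁ (finitePoint w w₂≢0)
    t∼w = proj₂ (finitePoint w w₂≢0)
    γw≡s : act γ w ≡ dir ρ
    γw≡s = cong₂ _,_
      (trans (solve 6 (λ a b c d x y → a :* (d :* x :- b :* y) :+ b :* (a :* y :- c :* x)
                                      := (a :* d :- b :* c) :* x)
                      refl (a γ) (b γ) (c γ) (d γ) x y)
             (trans (cong (_* x) (det γ)) (ℤP.*-identityˡ x)))
      (trans (solve 6 (λ a b c d x y → c :* (d :* x :- b :* y) :+ d :* (a :* y :- c :* x)
                                      := (a :* d :- b :* c) :* y)
                      refl (a γ) (b γ) (c γ) (d γ) x y)
             (trans (cong (_* y) (det γ)) (ℤP.*-identityˡ y)))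

  linked-sameBase : ∀ {σ τ} → base σ ∼ base τ → Linked σ τ
  linked-sameBase {σ} {τ} σ∼τ =
    linked-trans (linked-sym (linked-colSym γ γ∞∼σ))
                 (linked-colSym γ (∼-trans {col∞ γ} {base σ} {base τ} (nonzero-base σ) γ∞∼σ σ∼τ))
    where
    γ = proj₁ (∞-orbit (base σ))
    γ∞∼σ = proj₂ (∞-orbit (base σ))

  module WithModularSymbol (mod : I) (g-mod : g mod ≡ modSym∞0) where

    linked-mulS : ∀ γ → Linked (colSym γ) (colSym (mulS γ))
    linked-mulS γ = linked-resp (linked-gen γ mod g-mod)
      (≡⇒∼ (act-∞v γ) , ≡⇒∼ (act-0v γ))
      (≡⇒∼ (act-0v γ) , subst (_∼ col0 (mulS γ)) (sym (act-∞v γ))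
                          (trans (sym (ℤP.neg-distribʳ-* (a γ) (c γ))) (ℤP.neg-distribˡ-* (a γ) (c γ))))

    -- Euclid's algorithm on the bottom row (c , d) of γ, via γ ↦ γ T^k S.
    linked-colSym-π∞0 : ∀ γ → Linked (colSym γ) π∞0
    linked-colSym-π∞0 γ = descend ∣ c γ ∣ γ ℕP.≤-refl
      where
      descend : ∀ n γ → ∣ c γ ∣ ℕ.≤ n → Linked (colSym γ) π∞0
      descend n γ bound with c γ ℤP.≟ 0ℤ
      ... | yes c≡0 = linked-sameBase (trans (ℤP.*-zeroʳ (a γ)) (sym (trans (ℤP.*-identityˡ (c γ)) c≡0)))
      descend zero    γ bound | no c≢0 = ⊥-elim (c≢0 (ℤP.∣i∣≡0⇒i≡0 (ℕP.n≤0⇒n≡0 bound)))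
      descend (suc n) γ bound | no c≢0 =
        linked-trans (linked-sameBase {colSym γ} {colSym γ'} (∼-refl {col∞ γ}))
                     (linked-trans (linked-mulS γ') (descend n (mulS γ') smaller))
        where
        instance _ = ≢-nonZero c≢0
        γ' = mulT γ (- (d γ / c γ))
        d'≡d%c : c γ * - (d γ / c γ) + d γ ≡ ℤ.+ (d γ % c γ)
        d'≡d%c = begin
          c γ * - (d γ / c γ) + d γ
            ≡⟨ cong (c γ * - (d γ / c γ) +_) (a≡a%n+[a/n]*n (d γ) (c γ)) ⟩
          c γ * - (d γ / c γ) + (ℤ.+ (d γ % c γ) + d γ / c γ * c γ)
            ≡⟨ solve 3 (λ c q r → c :* (:- q) :+ (r :+ q :* c) := r) refl (c γ) (d γ / c γ) (ℤ.+ (d γ % c γ)) ⟩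
          ℤ.+ (d γ % c γ) ∎
        smaller : ∣ c (mulS γ') ∣ ℕ.≤ n
        smaller = ℕP.≤-trans (ℕP.≤-reflexive (cong ∣_∣ d'≡d%c)) (ℕP.≤-pred (ℕP.≤-trans (n%d<d (d γ) (c γ)) bound))

    linked-π∞0 : ∀ σ → Linked π∞0 σ
    linked-π∞0 σ = linked-trans (linked-sym (linked-colSym-π∞0 γ)) (linked-colSym γ γ∞∼σ)
      where
      γ = proj₁ (∞-orbit (base σ))
      γ∞∼σ = proj₂ (∞-orbit (base σ))


-- The canonical direction at r depends only on the point r ∈ P¹(ℚ).
canonicalDir : Vec2 → Vec2
canonicalDir r = if does (r ∼? ∞v) then 0v else ∞v

canonicalDir-distinct : ∀ {r} → Nonzero r → ¬ r ∼ canonicalDir r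
canonicalDir-distinct {r} r≢0 with r ∼? ∞v
... | yes r∼∞ = λ r∼0 → ∞≁0 (∼-trans {∞v} {r} {0v} r≢0 (sym r∼∞) r∼0)
  where ∞≁0 : ¬ ∞v ∼ 0v
        ∞≁0 ()
... | no r≁∞  = r≁∞

canonicalDir-cong : ∀ {r r'} → Nonzero r → Nonzero r' → r ∼ r' → canonicalDir r ≡ canonicalDir r'
canonicalDir-cong {r} {r'} r≢0 r'≢0 r∼r' with r ∼? ∞v | r' ∼? ∞v
... | yes _   | yes _    = refl
... | no _    | no _     = refl
... | yes r∼∞ | no r'≁∞ = ⊥-elim (r'≁∞ (∼-trans {r'} {r} {∞v} r≢0 (sym r∼r') r∼∞))
... | no r≁∞  | yes r'∼∞ = ⊥-elim (r≁∞ (∼-trans {r} {r'} {∞v} r'≢0 r∼r' r'∼∞))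

anchor : Sym → Sym
anchor σ = π (base σ) (canonicalDir (base σ)) (canonicalDir-distinct (nonzero-base σ))

relabel-anchor-null : ∀ x → InW x → ∀ τ → coeff (relabel anchor x) τ ≡ 0ℤ
relabel-anchor-null x x∈W τ with canonicalDir (base τ) ∼? dir τ
... | yes canonical = trans (coeff-relabel-∂ anchor τ (base τ) to (λ _ → proj₁) x)
                            (x∈W (pt (base τ) (nonzero-base τ)))
  where
  to : ∀ σ → base σ ∼ base τ → anchor σ ≈Sym τ
  to σ σ∼τ = σ∼τ , subst (_∼ dir τ) (sym (canonicalDir-cong (nonzero-base σ) (nonzero-base τ) σ∼τ)) canonical
... | no noncanonical = coeff-relabel-absent anchor τ absent x
  where
  absent : ∀ σ → ¬ anchor σ ≈Sym τ
  absent σ (σ∼τ , e) =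
    noncanonical (subst (_∼ dir τ) (canonicalDir-cong (nonzero-base σ) (nonzero-base τ) σ∼τ) e)

relabel-π∞0-null : ∀ x → InΞ₀ x → ∀ τ → coeff (relabel (λ _ → π∞0) x) τ ≡ 0ℤ
relabel-π∞0-null x x∈Ξ₀ τ with π∞0 ≈Sym? τ
... | yes π∞0≈τ = trans (coeff-relabel-const π∞0 τ π∞0≈τ x) x∈Ξ₀
... | no π∞0≉τ  = coeff-relabel-absent (λ _ → π∞0) τ (λ _ → π∞0≉τ) x

infSym-sameBase-bracket : ∀ t → Σ Sym λ σ → Σ Sym λ τ → infSym t ≡ bracket σ τ × base σ ≡ base τ
infSym-sameBase-bracket t = _ , _ , refl , refl

module G₁ = Generated gens₁ inj₂ (λ _ → refl)
module G₂ = Generated gens₂ (λ t → t) (λ _ → refl)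

Ξ₀⊆span : ∀ x → InΞ₀ x → InSpan gens₁ x
Ξ₀⊆span x x∈Ξ₀ = Span.span-of-null-relabel gens₁ linked-π∞0 x (relabel-π∞0-null x x∈Ξ₀)
  where open G₁.WithModularSymbol (inj₁ tt) refl

span⊆Ξ₀ : ∀ x → InSpan gens₁ x → InΞ₀ x
span⊆Ξ₀ x x∈span = trans (deg≡linExt-1 x)
  (Span.linExt-span gens₁ (λ _ → 1ℤ) (λ _ → refl) (λ { γ (inj₁ _) → refl ; γ (inj₂ _) → refl }) x x∈span)

W⊆span : ∀ x → InW x → InSpan gens₂ x
W⊆span x x∈W = Span.span-of-null-relabel gens₂ (λ σ → G₂.linked-sameBase {anchor σ} {σ} (∼-refl {base σ}))
                 x (relabel-anchor-null x x∈W)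

span⊆W : ∀ x → InSpan gens₂ x → InW x
span⊆W x x∈span p = trans (∂coeff≡linExt-atBase (vec p) x)
  (Span.linExt-span gens₂ (atBase (vec p)) (λ {σ} {τ} → atBase-cong (vec p) {σ} {τ})
     (λ γ t → generator-null γ t) x x∈span)
  where
  generator-null : ∀ γ t → linExt (atBase (vec p)) (actΞ γ (infSym t)) ≡ 0ℤ
  generator-null γ t with infSym-sameBase-bracket t
  ... | σ , τ , infSym≡ , base≡ =
    trans (cong (λ z → linExt (atBase (vec p)) (actΞ γ z)) infSym≡)
          (linExt-bracket-null (atBase (vec p)) {actSym γ σ} {actSym γ τ}
             (cong (pointIndicator (vec p) ∘ act γ) base≡))

proposition1p5 :
    (∀ (x : Ξ) → (InΞ₀ x → InSpan gens₁ x) × (InSpan gens₁ x → InΞ₀ x))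
    × (∀ (x : Ξ) → (InW x → InSpan gens₂ x) × (InSpan gens₂ x → InW x))
proposition1p5 = (λ x → Ξ₀⊆span x , span⊆Ξ₀ x) , (λ x → W⊆span x , span⊆W x)
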